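{- The number of Independent Set queries needed for Graph Reconstruction on $n$-vertex graphs of maximum degree $\Delta=\Omega(\log n)$ is $\Omega(n\Delta\log(\frac{n}{\Delta}))$: any algorithm that reconstructs every such graph using Independent Set queries must make $\Omega(n\Delta\log(\frac{n}{\Delta}))$ queries in the worst case.
   Context: Graph Reconstruction problem: an algorithm initially knows only the vertex set $V$ ($|V|=n$) of an unknown simple undirected input graph $G=(V,E)$ and must determine $E$. An Independent Set query submits a subset $U\subseteq V$ and receives a single bit indicating whether $U$ is an independent set in $G$. The hypothesis $\Delta=\Omega(\log n)$ means $\Delta\ge c\log n$ for a suitable sufficiently large absolute constant $c$. -}

module Defs where

open import Data.Nat using (ℕ; zero; suc; _+_; _≤_)
open import Data.Bool using (Bool; true; false; _∧_; not; if_then_else_)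
open import Data.Fin using (Fin)
open import Data.Fin.Subset using (Subset; _∈_)
open import Data.List.Base using (List; map; all; allFin)
open import Data.Nat.ListAction using (sum)
open import Data.Vec using (lookup)
open import Relation.Binary.PropositionalEquality using (_≡_)
open import Data.Empty using (⊥)

record Graph (n : ℕ) : Set where
  field
    adj    : Fin n → Fin n → Bool
    sym    : ∀ u v → adj u v ≡ adj v u
    irrefl : ∀ v → adj v v ≡ false
open Graph public

SameEdges : ∀ {n} → Graph n → Graph n → Set
SameEdges G H = ∀ u v → adj G u v ≡ adj H u v

degree : ∀ {n} → Graph n → Fin n → ℕ
degree {n} G v = sum (map (λ u → if adj G v u then 1 else 0) (allFin n))

MaxDegree≤ : ∀ {n} → Graph n → ℕ → Set
MaxDegree≤ G Δ = ∀ v → degree G v ≤ Δ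

isIndependent : ∀ {n} → Graph n → Subset n → Bool
isIndependent {n} G U =
  all (λ u → all (λ v → not (lookup U u ∧ lookup U v ∧ adj G u v)) (allFin n)) (allFin n)

-- A deterministic adaptive algorithm making Independent Set queries:
-- a decision tree whose internal nodes query a subset U ⊆ V and branch on
-- the answer bit, and whose leaves output a graph on V.
data Algorithm (n : ℕ) : Set where
  output : Graph n → Algorithm n
  query  : Subset n → (Bool → Algorithm n) → Algorithm n

run : ∀ {n} → Algorithm n → Graph n → Graph n
run (output H) G = H
run (query U k) G = run (k (isIndependent G U)) G

queries : ∀ {n} → Algorithm n → Graph n → ℕ
queries (output H) G = zero
queries (query U k) G = suc (queries (k (isIndependent G U)) G)

Reconstructs : ∀ {n} → Algorithm n → ℕ → Set
Reconstructs {n} A Δ = ∀ (G : Graph n) → MaxDegree≤ G Δ → SameEdges (run A G) G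

module Submission where

-- A decision tree making at most q queries has at most 2^q leaves, so an algorithm that reconstructs
-- N pairwise different graphs makes at least log₂ N queries on one of them. The hard family: take
-- d left and d right blocks of 2t vertices each, join every left block i to every right block j by
-- a perfect matching σᵢⱼ, and pad with isolated vertices. Each vertex has at most one neighbour in
-- each block of the other side, hence degree ≤ 2d, and since there are at least t^t injections
-- Fin 2t → Fin 2t the family has t^(d²t) members on 4dt vertices. Taking d ≈ Δ/2, t ≈ n/(4Δ)
-- (or t = 2, d ≈ n/16 when n ≤ 8Δ) makes log₂ t^(d²t) = d²t log₂ t ≥ nΔ log₂(n/Δ) / 2048.

open import Defs hiding (sym)
open import Data.Nat
  using (ℕ; zero; suc; _≤_; _<_; _+_; _*_; _^_; _∸_; z≤n; s≤s; _≤?_; NonZero; >-nonZero)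
open import Data.Nat.Properties
  using (≤-refl; ≤-reflexive; ≤-trans; ≤-total; ≤-pred; <⇒≤; ≰⇒>; m≤m+n; m≤n*m; m+[n∸m]≡n;
         +-mono-≤; +-monoˡ-≤; +-monoˡ-<; *-comm; *-assoc; *-mono-≤; *-monoˡ-≤; *-monoʳ-≤;
         *-cancelˡ-≤; ^-identityʳ; ^-*-assoc; ^-monoˡ-≤; ^-monoʳ-≤; m^n>0; m^n≢0;
         module ≤-Reasoning)
open import Data.Nat.DivMod
  using (_/_; m≡m%n+[m/n]*n; m%n<n; m/n*n≤m; m≥n⇒m/n>0; m*n/n≡m; /-monoˡ-≤)
open import Data.Nat.Tactic.RingSolver using (solve-∀)
open import Data.Nat.ListAction using (sum)
open import Data.Bool using (Bool; true; false; _∨_; if_then_else_)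
open import Data.Bool.Properties using (∨-comm; ∨-identityʳ)
open import Data.Fin
  using (Fin; zero; suc; _↑ʳ_; punchIn; punchOut; combine; fromℕ<; _≟_; finToFun; funToFin)
open import Data.Fin.Properties
  using (suc-injective; 0≢1+n; ↑ʳ-injective; punchIn-injective; punchInᵢ≢i; punchOut-injective;
         combine-injective; combine-surjective; injective⇒≤; funToFin-finToFin; +↔⊎; *↔×)
open import Data.List using (tabulate)
open import Data.List.Properties using (map-tabulate)
open import Data.Product using (Σ; ∃; _×_; _,_)
open import Data.Sum using (_⊎_; inj₁; inj₂)
open import Data.Sum.Function.Propositional using (_⊎-↔_)
open import Data.Empty using (⊥-elim)
open import Function using (_∘_; id)
open import Function.Bundles using (_↔_; Inverse; Injection)
open import Function.Properties.Inverse using (↔-refl; ↔-trans; ↔⇒↣)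
open import Relation.Nullary using (Dec; does; yes; no)
open import Relation.Nullary.Decidable using (dec-true)
open import Relation.Binary.PropositionalEquality
  using (_≡_; _≢_; _≗_; refl; sym; trans; cong; cong₂; subst; module ≡-Reasoning)

indicator : Bool → ℕ
indicator b = if b then 1 else 0

count : ∀ {n} → (Fin n → Bool) → ℕ
count b = sum (tabulate (indicator ∘ b))

degree≡count : ∀ {n} (G : Graph n) v → degree G v ≡ count (adj G v)
degree≡count G v = cong sum (map-tabulate id (indicator ∘ adj G v))

indicator-∨ : ∀ a b → indicator (a ∨ b) ≤ indicator a + indicator b
indicator-∨ false b     = ≤-refl
indicator-∨ true  false = ≤-refl
indicator-∨ true  true  = s≤s z≤n

count-∨ : ∀ {n} (a b : Fin n → Bool) → count (λ u → a u ∨ b u) ≤ count a + count b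
count-∨ {zero}  a b = z≤n
count-∨ {suc n} a b = ≤-trans
  (+-mono-≤ (indicator-∨ (a zero) (b zero)) (count-∨ (a ∘ suc) (b ∘ suc)))
  (≤-reflexive (interchange (indicator (a zero)) (indicator (b zero)) _ _))
  where
  interchange : ∀ w x y z → (w + x) + (y + z) ≡ (w + y) + (x + z)
  interchange = solve-∀

count≤ : ∀ {n d} (b : Fin n → Bool) (f : ∀ u → b u ≡ true → Fin d) →
         (∀ {u v} p q → f u p ≡ f v q → u ≡ v) → count b ≤ d
count≤ {zero} b f f-inj = z≤n
count≤ {suc n} b f f-inj with b zero in b₀
... | false = count≤ (b ∘ suc) (f ∘ suc) (λ p q → suc-injective ∘ f-inj p q)
count≤ {suc n} {zero}  b f f-inj | true with () ← f zero b₀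
count≤ {suc n} {suc d} b f f-inj | true =
  s≤s (count≤ (b ∘ suc) (λ u p → punchOut (f₀≢ u p))
              (λ p q → suc-injective ∘ f-inj p q ∘ punchOut-injective (f₀≢ _ p) (f₀≢ _ q)))
  where
  f₀≢ : ∀ u p → f zero b₀ ≢ f (suc u) p
  f₀≢ u p = 0≢1+n ∘ f-inj b₀ p

fromArcs : ∀ {n} (E : Fin n → Fin n → Bool) → (∀ v → E v v ≡ false) → Graph n
fromArcs E loopless = record
  { adj    = λ u v → E u v ∨ E v u
  ; sym    = λ u v → ∨-comm (E u v) (E v u)
  ; irrefl = λ v → cong (λ b → b ∨ b) (loopless v)
  }

degree-fromArcs : ∀ {n} E loopless (v : Fin n) →
                  degree (fromArcs E loopless) v ≤ count (E v) + count (λ u → E u v)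
degree-fromArcs E loopless v =
  ≤-trans (≤-reflexive (degree≡count (fromArcs E loopless) v)) (count-∨ (E v) (λ u → E u v))

empty : ∀ n → Graph n
empty n = fromArcs (λ _ _ → false) (λ _ → refl)

empty-maxDegree : ∀ {n} Δ → MaxDegree≤ (empty n) Δ
empty-maxDegree {n} Δ v = ≤-trans (degree-fromArcs (λ _ _ → false) (λ _ → refl) v)
  (≤-trans (+-mono-≤ none none) z≤n)
  where
  none : count {n} (λ _ → false) ≤ 0
  none = count≤ {n} (λ _ → false) (λ _ ()) λ ()

-- Decision trees

bit : Bool → Fin 2
bit false = zero
bit true  = suc zero

bit-injective : ∀ {a b} → bit a ≡ bit b → a ≡ b
bit-injective {false} {false} _ = refl
bit-injective {true}  {true}  _ = refl

-- The answers to the first Q queries in binary; junk (but well defined) if A asks more than Q.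
transcript : ∀ {n} → Algorithm n → (Q : ℕ) → Graph n → Fin (2 ^ Q)
transcript (output _)  Q       G = fromℕ< (m^n>0 2 Q)
transcript (query U k) zero    G = zero
transcript (query U k) (suc Q) G =
  combine (bit (isIndependent G U)) (transcript (k (isIndependent G U)) Q G)

transcript-determines-run : ∀ {n} (A : Algorithm n) {Q} G H →
  queries A G ≤ Q → queries A H ≤ Q → transcript A Q G ≡ transcript A Q H → run A G ≡ run A H
transcript-determines-run (output _)  G H _ _ _ = refl
transcript-determines-run (query U k) {suc Q} G H (s≤s qG) (s≤s qH) e
  with isIndependent G U | isIndependent H U
... | a | b with combine-injective (bit a) _ (bit b) _ e
... | ba≡bb , e′ with refl ← bit-injective ba≡bb = transcript-determines-run (k a) G H qG qH e′

argmax : ∀ {N} (h : Fin (suc N) → ℕ) → ∃ λ i → ∀ j → h j ≤ h i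
argmax {zero}  h = zero , λ { zero → ≤-refl }
argmax {suc N} h with argmax (h ∘ suc)
... | i , hᵢ-max with ≤-total (h zero) (h (suc i))
... | inj₁ h₀≤ = suc i , λ { zero → h₀≤ ; (suc j) → hᵢ-max j }
... | inj₂ ≤h₀ = zero  , λ { zero → ≤-refl ; (suc j) → ≤-trans (hᵢ-max j) ≤h₀ }

queries-lower-bound : ∀ {n N} (A : Algorithm n) (g : Fin N → Graph n) →
  (∀ i → SameEdges (run A (g i)) (g i)) → (∀ i j → SameEdges (g i) (g j) → i ≡ j) →
  0 < N → ∃ λ i → N ≤ 2 ^ queries A (g i)
queries-lower-bound A g reconstructs distinct (s≤s z≤n) with argmax (queries A ∘ g)
... | i , i-max = i , injective⇒≤ transcript-injective
  where
  Q : ℕ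
  Q = queries A (g i)
  transcript-injective : ∀ {a b} → transcript A Q (g a) ≡ transcript A Q (g b) → a ≡ b
  transcript-injective {a} {b} e = distinct a b λ u v → begin
    adj (g a) u v           ≡⟨ sym (reconstructs a u v) ⟩
    adj (run A (g a)) u v   ≡⟨ cong (λ G → adj G u v) (transcript-determines-run A _ _ (i-max a) (i-max b) e) ⟩
    adj (run A (g b)) u v   ≡⟨ reconstructs b u v ⟩
    adj (g b) u v           ∎
    where open ≡-Reasoning

-- The hard family

-- Injections Fin (k + t) → Fin (k + t) coding functions Fin k → Fin t: the image of 0 is k + g 0,
-- and the rest is the injection of g ∘ suc with that value punched in.
toInjection : ∀ {t} k → (Fin k → Fin t) → Fin (k + t) → Fin (k + t)
toInjection zero    g x       = x
toInjection (suc k) g zero    = suc k ↑ʳ g zero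
toInjection (suc k) g (suc x) = punchIn (suc k ↑ʳ g zero) (toInjection k (g ∘ suc) x)

toInjection-injective : ∀ {t} k (g : Fin k → Fin t) {x y} →
                        toInjection k g x ≡ toInjection k g y → x ≡ y
toInjection-injective zero    g e = e
toInjection-injective (suc k) g {zero}  {zero}  e = refl
toInjection-injective (suc k) g {zero}  {suc y} e = ⊥-elim (punchInᵢ≢i _ _ (sym e))
toInjection-injective (suc k) g {suc x} {zero}  e = ⊥-elim (punchInᵢ≢i _ _ e)
toInjection-injective (suc k) g {suc x} {suc y} e =
  cong suc (toInjection-injective k (g ∘ suc) (punchIn-injective _ _ _ e))

toInjection-cancel : ∀ {t} k (g h : Fin k → Fin t) → toInjection k g ≗ toInjection k h → g ≗ h
toInjection-cancel (suc k) g h e zero    = ↑ʳ-injective (suc k) _ _ (e zero)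
toInjection-cancel (suc k) g h e (suc y) = toInjection-cancel k (g ∘ suc) (h ∘ suc) e′ y
  where
  e′ : toInjection k (g ∘ suc) ≗ toInjection k (h ∘ suc)
  e′ x with e zero | e (suc x)
  ... | e₀ | eₓ rewrite ↑ʳ-injective (suc k) (g zero) (h zero) e₀ = punchIn-injective _ _ _ eₓ

does-sound : ∀ {A : Set} (a? : Dec A) → does a? ≡ true → A
does-sound (yes a) _ = a
does-sound (no _)  ()

Slot : ℕ → ℕ → Set
Slot d s = Fin d × Fin s

Layout : ℕ → ℕ → ℕ → Set
Layout d s r = (Slot d s ⊎ Slot d s) ⊎ Fin r

pattern left  i x = inj₁ (inj₁ (i , x))
pattern right j y = inj₁ (inj₂ (j , y))

layout : ∀ {n d s} → d * s + d * s ≤ n → Fin n ↔ Layout d s (n ∸ (d * s + d * s))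
layout {n} {d} {s} fits = subst (λ m → Fin m ↔ Layout d s (n ∸ (d * s + d * s))) (m+[n∸m]≡n fits)
  (↔-trans +↔⊎ (↔-trans (+↔⊎ {d * s}) (*↔× {d} ⊎-↔ *↔× {d}) ⊎-↔ ↔-refl))

Choice : ℕ → ℕ → Set
Choice d t = Fin d → Fin d → Fin t → Fin t

module HardFamily {n d t r : ℕ} (ℓ : Fin n ↔ Layout d (t + t) r) where
  open Inverse ℓ using (to; from; strictlyInverseˡ)
  open Injection (↔⇒↣ ℓ) using (injective)

  module _ (F : Choice d t) where

    σ : Fin d → Fin d → Fin (t + t) → Fin (t + t)
    σ i j = toInjection t (F i j)

    link : Layout d (t + t) r → Layout d (t + t) r → Bool
    link (left i x) (right j y) = does (σ i j x ≟ y)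
    link _          _           = false

    link-irrefl : ∀ p → link p p ≡ false
    link-irrefl (inj₁ (inj₁ _)) = refl
    link-irrefl (inj₁ (inj₂ _)) = refl
    link-irrefl (inj₂ _)        = refl

    outBlock : ∀ p q → link p q ≡ true → Fin d
    outBlock (left i x) (right j y) _ = j

    outBlock-injective : ∀ p q q′ e e′ → outBlock p q e ≡ outBlock p q′ e′ → q ≡ q′
    outBlock-injective (left i x) (right j y) (right .j y′) e e′ refl =
      cong (right j) (trans (sym (does-sound (σ i j x ≟ y) e)) (does-sound (σ i j x ≟ y′) e′))

    inBlock : ∀ p q → link p q ≡ true → Fin d
    inBlock (left i x) (right j y) _ = i

    inBlock-injective : ∀ p p′ q e e′ → inBlock p q e ≡ inBlock p′ q e′ → p ≡ p′
    inBlock-injective (left i x) (left .i x′) (right j y) e e′ refl =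
      cong (left i) (toInjection-injective t (F i j)
        (trans (does-sound (σ i j x ≟ y) e) (sym (does-sound (σ i j x′ ≟ y) e′))))

    arc : Fin n → Fin n → Bool
    arc u v = link (to u) (to v)

    graph : Graph n
    graph = fromArcs arc (link-irrefl ∘ to)

    graph-maxDegree : MaxDegree≤ graph (d + d)
    graph-maxDegree v = ≤-trans (degree-fromArcs arc (link-irrefl ∘ to) v) (+-mono-≤
      (count≤ (arc v) (λ u → outBlock (to v) (to u))
              (λ e e′ → injective ∘ outBlock-injective (to v) _ _ e e′))
      (count≤ (λ u → arc u v) (λ u → inBlock (to u) (to v))
              (λ e e′ → injective ∘ inBlock-injective _ _ (to v) e e′)))

    adj-left-right : ∀ i x j y → adj graph (from (left i x)) (from (right j y)) ≡ does (σ i j x ≟ y)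
    adj-left-right i x j y rewrite strictlyInverseˡ (left i x) | strictlyInverseˡ (right j y) =
      ∨-identityʳ _

  graph-injective : ∀ F F′ → SameEdges (graph F) (graph F′) → ∀ i j → F i j ≗ F′ i j
  graph-injective F F′ same i j =
    toInjection-cancel t (F i j) (F′ i j) λ x → sym (does-sound (σ F′ i j x ≟ σ F i j x) (begin
      does (σ F′ i j x ≟ σ F i j x)  ≡⟨ sym (adj-left-right F′ i x j _) ⟩
      adj (graph F′) _ _             ≡⟨ sym (same _ _) ⟩
      adj (graph F) _ _              ≡⟨ adj-left-right F i x j _ ⟩
      does (σ F i j x ≟ σ F i j x)   ≡⟨ dec-true (σ F i j x ≟ σ F i j x) refl ⟩
      true                           ∎))
    where open ≡-Reasoning

funToFin-cong : ∀ {m k} {f g : Fin m → Fin k} → f ≗ g → funToFin f ≡ funToFin g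
funToFin-cong {zero}  e = refl
funToFin-cong {suc m} e = cong₂ combine (e zero) (funToFin-cong (e ∘ suc))

finToFun-injective : ∀ {m k} {a b : Fin (k ^ m)} → finToFun {k} {m} a ≗ finToFun b → a ≡ b
finToFun-injective {m} {k} {a} {b} e = begin
  a                                        ≡⟨ sym (funToFin-finToFin {m} {k} a) ⟩
  funToFin {m} {k} (finToFun {k} {m} a)    ≡⟨ funToFin-cong {m} {k} e ⟩
  funToFin {m} {k} (finToFun {k} {m} b)    ≡⟨ funToFin-finToFin {m} {k} b ⟩
  b                                        ∎
  where open ≡-Reasoning

choice : ∀ {d t} → Fin (t ^ (d * (d * t))) → Choice d t
choice c i j x = finToFun c (combine i (combine j x))

choice-injective : ∀ {d t} {a b : Fin (t ^ (d * (d * t)))} →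
                   (∀ i j → choice a i j ≗ choice b i j) → a ≡ b
choice-injective {d} {t} {a} {b} e = finToFun-injective {d * (d * t)} {t} agree
  where
  agree : finToFun {t} {d * (d * t)} a ≗ finToFun b
  agree k with i , jx , refl ← combine-surjective {d} k
          with j , x , refl ← combine-surjective {d} {t} jx = e i j x

family-lower-bound : ∀ {n d t r Δ} .{{_ : NonZero t}} → Fin n ↔ Layout d (t + t) r → d + d ≤ Δ →
  (A : Algorithm n) → Reconstructs A Δ →
  Σ (Graph n) λ G → MaxDegree≤ G Δ × t ^ (d * (d * t)) ≤ 2 ^ queries A G
family-lower-bound {d = d} {t} {Δ = Δ} ℓ 2d≤Δ A reconstructs =
  let c , bound = queries-lower-bound A (graph ∘ choice) (λ c → reconstructs _ (maxDegree c))
                    (λ a b same → choice-injective (graph-injective _ _ same)) (m^n>0 t (d * (d * t)))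
  in graph (choice c) , maxDegree c , bound
  where
  open HardFamily {t = t} ℓ
  maxDegree : ∀ c → MaxDegree≤ (graph (choice c)) Δ
  maxDegree c v = ≤-trans (graph-maxDegree (choice c) v) 2d≤Δ

-- Arithmetic

^-distribʳ-* : ∀ m n o → (m * n) ^ o ≡ m ^ o * n ^ o
^-distribʳ-* m n zero    = refl
^-distribʳ-* m n (suc o) =
  trans (cong (m * n *_) (^-distribʳ-* m n o)) (interchange m n (m ^ o) (n ^ o))
  where
  interchange : ∀ w x y z → (w * x) * (y * z) ≡ (w * y) * (x * z)
  interchange = solve-∀

^-scale : ∀ {b X q e} c .{{_ : NonZero b}} → b ^ X ≤ 2 ^ q → e ≤ c * X → b ^ e ≤ 2 ^ (c * q)
^-scale {b} {X} {q} {e} c bˣ≤2^q e≤cX = begin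
  b ^ e         ≤⟨ ^-monoʳ-≤ b (≤-trans e≤cX (≤-reflexive (*-comm c X))) ⟩
  b ^ (X * c)   ≡⟨ sym (^-*-assoc b X c) ⟩
  (b ^ X) ^ c   ≤⟨ ^-monoˡ-≤ c bˣ≤2^q ⟩
  (2 ^ q) ^ c   ≡⟨ ^-*-assoc 2 q c ⟩
  2 ^ (q * c)   ≡⟨ cong (2 ^_) (*-comm q c) ⟩
  2 ^ (c * q)   ∎
  where open ≤-Reasoning

bound-from-family : ∀ {n Δ d t q} .{{_ : NonZero t}} → n ≤ Δ * t ^ 4 → n * Δ ≤ 512 * (d * (d * t)) →
  t ^ (d * (d * t)) ≤ 2 ^ q → n ^ (n * Δ) ≤ 2 ^ (2048 * q) * Δ ^ (n * Δ)
bound-from-family {n} {Δ} {d} {t} {q} n≤Δt⁴ nΔ≤ family≤2^q = begin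
  n ^ (n * Δ)                        ≤⟨ ^-monoˡ-≤ (n * Δ) n≤Δt⁴ ⟩
  (Δ * t ^ 4) ^ (n * Δ)              ≡⟨ ^-distribʳ-* Δ (t ^ 4) (n * Δ) ⟩
  Δ ^ (n * Δ) * (t ^ 4) ^ (n * Δ)    ≡⟨ cong (Δ ^ (n * Δ) *_) (^-*-assoc t 4 (n * Δ)) ⟩
  Δ ^ (n * Δ) * t ^ (4 * (n * Δ))    ≤⟨ *-monoʳ-≤ (Δ ^ (n * Δ)) t^[4nΔ]≤2^[2048q] ⟩
  Δ ^ (n * Δ) * 2 ^ (2048 * q)       ≡⟨ *-comm (Δ ^ (n * Δ)) _ ⟩
  2 ^ (2048 * q) * Δ ^ (n * Δ)       ∎
  where
  open ≤-Reasoning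
  4nΔ≤ : 4 * (n * Δ) ≤ 2048 * (d * (d * t))
  4nΔ≤ = ≤-trans (*-monoʳ-≤ 4 nΔ≤) (≤-reflexive (sym (*-assoc 4 512 (d * (d * t)))))
  t^[4nΔ]≤2^[2048q] : t ^ (4 * (n * Δ)) ≤ 2 ^ (2048 * q)
  t^[4nΔ]≤2^[2048q] = ^-scale {X = d * (d * t)} {q} 2048 family≤2^q 4nΔ≤

m<[1+m/n]*n : ∀ m n .{{_ : NonZero n}} → m < suc (m / n) * n
m<[1+m/n]*n m n =
  subst (_< suc (m / n) * n) (sym (m≡m%n+[m/n]*n m n)) (+-monoˡ-< (m / n * n) (m%n<n m n))

-- Block count d and block size 2t for the hard family on n vertices with maximum degree Δ.
record Parameters (n Δ : ℕ) : Set where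
  field
    d t            : ℕ
    {{t-nonZero}}  : NonZero t
    fits           : d * (t + t) + d * (t + t) ≤ n
    2d≤Δ           : d + d ≤ Δ
    n≤Δt⁴          : n ≤ Δ * t ^ 4
    nΔ≤512d²t      : n * Δ ≤ 512 * (d * (d * t))

dense-parameters : ∀ {n Δ} → 16 ≤ n → Δ < n → n ≤ 8 * Δ → Parameters n Δ
dense-parameters {n} {Δ} 16≤n Δ<n n≤8Δ = record
  { d = d ; t = 2
  ; fits      = ≤-trans (≤-reflexive (d*4+d*4≡d*8 d)) (≤-trans (*-monoʳ-≤ d (m≤m+n 8 8)) 16d≤n)
  ; 2d≤Δ      = *-cancelˡ-≤ 8 (≤-trans (≤-reflexive (8*[d+d]≡d*16 d)) (≤-trans 16d≤n n≤8Δ))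
  ; n≤Δt⁴     = ≤-trans n≤8Δ (≤-trans (*-monoˡ-≤ Δ (m≤m+n 8 8)) (≤-reflexive (*-comm 16 Δ)))
  ; nΔ≤512d²t = ≤-trans (*-mono-≤ n≤32d (≤-trans (<⇒≤ Δ<n) n≤32d))
                        (≤-reflexive (d*32*[d*32]≡512*[d*[d*2]] d))
  }
  where
  open ≤-Reasoning
  d*4+d*4≡d*8 : ∀ d → d * (2 + 2) + d * (2 + 2) ≡ d * 8
  d*4+d*4≡d*8 = solve-∀
  8*[d+d]≡d*16 : ∀ d → 8 * (d + d) ≡ d * 16
  8*[d+d]≡d*16 = solve-∀
  [d+d]*16≡d*32 : ∀ d → (d + d) * 16 ≡ d * 32
  [d+d]*16≡d*32 = solve-∀
  d*32*[d*32]≡512*[d*[d*2]] : ∀ d → d * 32 * (d * 32) ≡ 512 * (d * (d * 2))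
  d*32*[d*32]≡512*[d*[d*2]] = solve-∀
  d : ℕ
  d = n / 16
  16d≤n : d * 16 ≤ n
  16d≤n = m/n*n≤m n 16
  n≤32d : n ≤ d * 32
  n≤32d = begin
    n              ≤⟨ <⇒≤ (m<[1+m/n]*n n 16) ⟩
    suc d * 16     ≤⟨ *-monoˡ-≤ 16 (+-monoˡ-≤ d (m≥n⇒m/n>0 16≤n)) ⟩
    (d + d) * 16   ≡⟨ [d+d]*16≡d*32 d ⟩
    d * 32         ∎

sparse-parameters : ∀ {n Δ} → 2 ≤ Δ → 8 * Δ < n → Parameters n Δ
sparse-parameters {n} {Δ} 2≤Δ@(s≤s (s≤s z≤n)) 8Δ<n = record
  { d = d ; t = t ; t-nonZero = >-nonZero (≤-trans (s≤s z≤n) 2≤t)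
  ; fits      = begin
      d * (t + t) + d * (t + t)   ≡⟨ d[t+t]+d[t+t]≡t*[4*d] d t ⟩
      t * (4 * d)                 ≤⟨ *-monoʳ-≤ t (*-monoʳ-≤ 4 (≤-trans (m≤m+n d d) 2d≤Δ)) ⟩
      t * (4 * Δ)                 ≤⟨ m/n*n≤m n (4 * Δ) ⟩
      n                           ∎
  ; 2d≤Δ      = 2d≤Δ
  ; n≤Δt⁴     = ≤-trans n≤Δ*[t*8] (*-monoʳ-≤ Δ (*-monoʳ-≤ t (^-monoˡ-≤ 3 2≤t)))
  ; nΔ≤512d²t = begin
      n * Δ                       ≤⟨ *-mono-≤ n≤Δ*[t*8] Δ≤d*3 ⟩
      Δ * (t * 8) * (d * 3)       ≤⟨ *-monoˡ-≤ (d * 3) (*-monoˡ-≤ (t * 8) Δ≤d*3) ⟩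
      d * 3 * (t * 8) * (d * 3)   ≡⟨ d*3*[t*8]*[d*3]≡72*[d*[d*t]] d t ⟩
      72 * (d * (d * t))          ≤⟨ *-monoˡ-≤ (d * (d * t)) (m≤m+n 72 440) ⟩
      512 * (d * (d * t))         ∎
  }
  where
  open ≤-Reasoning
  d[t+t]+d[t+t]≡t*[4*d] : ∀ d t → d * (t + t) + d * (t + t) ≡ t * (4 * d)
  d[t+t]+d[t+t]≡t*[4*d] = solve-∀
  [t+t]*[4*Δ]≡Δ*[t*8] : ∀ t Δ → (t + t) * (4 * Δ) ≡ Δ * (t * 8)
  [t+t]*[4*Δ]≡Δ*[t*8] = solve-∀
  d*3*[t*8]*[d*3]≡72*[d*[d*t]] : ∀ d t → d * 3 * (t * 8) * (d * 3) ≡ 72 * (d * (d * t))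
  d*3*[t*8]*[d*3]≡72*[d*[d*t]] = solve-∀
  d+d≡d*2 : ∀ d → d + d ≡ d * 2
  d+d≡d*2 = solve-∀
  d+d*2≡d*3 : ∀ d → d + d * 2 ≡ d * 3
  d+d*2≡d*3 = solve-∀
  d t : ℕ
  d = Δ / 2
  t = n / (4 * Δ)
  2d≤Δ : d + d ≤ Δ
  2d≤Δ = ≤-trans (≤-reflexive (d+d≡d*2 d)) (m/n*n≤m Δ 2)
  Δ≤d*3 : Δ ≤ d * 3
  Δ≤d*3 = begin
    Δ           ≤⟨ ≤-pred (m<[1+m/n]*n Δ 2) ⟩
    1 + d * 2   ≤⟨ +-monoˡ-≤ (d * 2) (m≥n⇒m/n>0 2≤Δ) ⟩
    d + d * 2   ≡⟨ d+d*2≡d*3 d ⟩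
    d * 3       ∎
  2≤t : 2 ≤ t
  2≤t = subst (_≤ t) (m*n/n≡m 2 (4 * Δ))
    (/-monoˡ-≤ (4 * Δ) (≤-trans (≤-reflexive (sym (*-assoc 2 4 Δ))) (<⇒≤ 8Δ<n)))
  n≤Δ*[t*8] : n ≤ Δ * (t * 8)
  n≤Δ*[t*8] = begin
    n                   ≤⟨ <⇒≤ (m<[1+m/n]*n n (4 * Δ)) ⟩
    suc t * (4 * Δ)     ≤⟨ *-monoˡ-≤ (4 * Δ) (+-monoˡ-≤ t (≤-trans (s≤s z≤n) 2≤t)) ⟩
    (t + t) * (4 * Δ)   ≡⟨ [t+t]*[4*Δ]≡Δ*[t*8] t Δ ⟩
    Δ * (t * 8)         ∎

lower-bound-from-parameters : ∀ {n Δ} → Parameters n Δ → (A : Algorithm n) → Reconstructs A Δ →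
  Σ (Graph n) λ G → MaxDegree≤ G Δ × n ^ (n * Δ) ≤ 2 ^ (2048 * queries A G) * Δ ^ (n * Δ)
lower-bound-from-parameters P A reconstructs =
  let G , maxDegree , family≤2^q =
        family-lower-bound {d = d} {t} (layout fits) 2d≤Δ A reconstructs
  in G , maxDegree , bound-from-family {d = d} {q = queries A G} n≤Δt⁴ nΔ≤512d²t family≤2^q
  where open Parameters P

reconstruction-lower-bound : ∀ {n Δ} → 16 ≤ n → 2 ≤ Δ → (A : Algorithm n) → Reconstructs A Δ →
  Σ (Graph n) λ G → MaxDegree≤ G Δ × n ^ (n * Δ) ≤ 2 ^ (2048 * queries A G) * Δ ^ (n * Δ)
reconstruction-lower-bound {n} {Δ} 16≤n 2≤Δ A reconstructs with n ≤? Δ | n ≤? 8 * Δ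
... | yes n≤Δ | _        = empty n , empty-maxDegree Δ ,
  ≤-trans (^-monoˡ-≤ (n * Δ) n≤Δ) (m≤n*m _ _ {{m^n≢0 2 (2048 * queries A (empty n))}})
... | no n≰Δ  | yes n≤8Δ =
  lower-bound-from-parameters (dense-parameters 16≤n (≰⇒> n≰Δ) n≤8Δ) A reconstructs
... | no _    | no n≰8Δ  =
  lower-bound-from-parameters (sparse-parameters 2≤Δ (≰⇒> n≰8Δ)) A reconstructs

2≤exponent : ∀ {Δ} → 4 ≤ 2 ^ Δ → 2 ≤ Δ
2≤exponent {0}           (s≤s ())
2≤exponent {1}           (s≤s (s≤s ()))
2≤exponent {suc (suc _)} _ = s≤s (s≤s z≤n)

-- The hypothesis Δ ≥ log₂ n (c = 1) is only used to rule out Δ < 2.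
corollary9 : ∃ λ (c : ℕ) → ∃ λ (K : ℕ) → ∃ λ (N₀ : ℕ) →
    ∀ (n Δ : ℕ) → N₀ ≤ n → n ^ c ≤ 2 ^ Δ →
    ∀ (A : Algorithm n) → Reconstructs A Δ →
    Σ (Graph n) λ G → MaxDegree≤ G Δ ×
      n ^ (n * Δ) ≤ 2 ^ (K * queries A G) * Δ ^ (n * Δ)
corollary9 = 1 , 2048 , 16 , λ n Δ 16≤n n≤2^Δ →
  reconstruction-lower-bound 16≤n (2≤exponent (4≤2^Δ {n} {Δ} 16≤n n≤2^Δ))
  where
  4≤2^Δ : ∀ {n Δ} → 16 ≤ n → n ^ 1 ≤ 2 ^ Δ → 4 ≤ 2 ^ Δ
  4≤2^Δ {n} {Δ} 16≤n n≤2^Δ = begin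
    4       ≤⟨ ≤-trans (m≤m+n 4 12) 16≤n ⟩
    n       ≡⟨ sym (^-identityʳ n) ⟩
    n ^ 1   ≤⟨ n≤2^Δ ⟩
    2 ^ Δ   ∎
    where open ≤-Reasoning
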